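{- Let $s$ be a positive integer and $i\in\{1,2,3\}$, and let $\mathcal{Z}_i=\mathcal{Z}_i(U_i,V_i)$ be the bipartite graph defined below. Let $U_i=U\cup U'$ and $V_i=V\cup V'$ be partitions of $U_i$ and $V_i$, respectively. If $|U|+|V|-|U\cap\{u_{s+1}\}|-|V\cap\{v_{s+1}\}|\equiv 0\pmod 2$, then $e(\mathcal{Z}_i[U,V])+e(\mathcal{Z}_i[U',V'])\equiv s\pmod 2$. If $|U|+|V|-|U\cap\{u_{s+1}\}|-|V\cap\{v_{s+1}\}|\equiv 1\pmod 2$, then $e(\mathcal{Z}_i[U,V])+e(\mathcal{Z}_i[U',V'])\equiv s+1\pmod 2$.
   Context: $\mathcal{Z}_1(U_1,V_1)$ is the bipartite graph with parts $U_1=\{u_1,\dots,u_s\}$, $V_1=\{v_1,\dots,v_s\}$ and edge set $\{u_jv_j:1\le j\le s\}$. $\mathcal{Z}_2(U_2,V_2)$ has parts $U_2=\{u_1,\dots,u_s,u_{s+1}\}$, $V_2=\{v_1,\dots,v_s\}$ and edge set $\{u_jv_j:1\le j\le s\}$. $\mathcal{Z}_3(U_3,V_3)$ has parts $U_3=\{u_1,\dots,u_s\}$, $V_3=\{v_1,\dots,v_s,v_{s+1}\}$ and edge set $\{u_jv_j:1\le j\le s\}$. (When $u_{s+1}$ or $v_{s+1}$ is not a vertex of the graph, intersections with $\{u_{s+1}\}$ or $\{v_{s+1}\}$ are empty.) For $U\subset U_i$, $V\subset V_i$, $e(\mathcal{Z}_i[U,V])$ is the number of edges of $\mathcal{Z}_i$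 with one endpoint in $U$ and the other in $V$. -}

module Defs where

open import Data.Nat using (ℕ; zero; suc; _+_; _<_; _≟_; _<?_)
open import Data.Fin using (Fin; toℕ; fromℕ)
open import Data.Fin.Subset using (Subset; _∈_; ∣_∣)
open import Data.Fin.Subset.Properties using (_∈?_)
open import Data.Bool using (Bool; true; false)
open import Data.Product using (_×_; _,_)
open import Data.List using (List; length; filter; allFin; cartesianProduct)
open import Relation.Nullary using (Dec; yes; no)
open import Relation.Nullary.Decidable using (_×-dec_)
open import Relation.Binary.PropositionalEquality using (_≡_)

-- The graph Z_i(U_i,V_i), for i ∈ {1,2,3} encoded as Fin 3 (0 ↦ Z_1, 1 ↦ Z_2, 2 ↦ Z_3).
-- Vertex u_{j+1} is index j : Fin (nU s i), and likewise v_{j+1} in Fin (nV s i).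
-- In Z_2 the index s is u_{s+1}; in Z_3 the index s is v_{s+1}.

nU : ℕ → Fin 3 → ℕ
nU s Fin.zero = s
nU s (Fin.suc Fin.zero) = suc s
nU s (Fin.suc (Fin.suc Fin.zero)) = s

nV : ℕ → Fin 3 → ℕ
nV s Fin.zero = s
nV s (Fin.suc Fin.zero) = s
nV s (Fin.suc (Fin.suc Fin.zero)) = suc s

Edge : (s : ℕ) (i : Fin 3) → Fin (nU s i) → Fin (nV s i) → Set
Edge s i x y = (toℕ x ≡ toℕ y) × (toℕ x < s)

Edge? : (s : ℕ) (i : Fin 3) (x : Fin (nU s i)) (y : Fin (nV s i)) → Dec (Edge s i x y)
Edge? s i x y = (toℕ x ≟ toℕ y) ×-dec (toℕ x <? s)

eZ : (s : ℕ) (i : Fin 3) → Subset (nU s i) → Subset (nV s i) → ℕ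
eZ s i U V = length (filter (λ p → let (x , y) = p in
                               ((x ∈? U) ×-dec (y ∈? V)) ×-dec Edge? s i x y)
                            (cartesianProduct (allFin (nU s i)) (allFin (nV s i))))

capU : (s : ℕ) (i : Fin 3) → Subset (nU s i) → ℕ
capU s (Fin.suc Fin.zero) U with fromℕ s ∈? U
... | yes _ = 1
... | no _ = 0
capU s Fin.zero U = 0
capU s (Fin.suc (Fin.suc Fin.zero)) U = 0

capV : (s : ℕ) (i : Fin 3) → Subset (nV s i) → ℕ
capV s (Fin.suc (Fin.suc Fin.zero)) V with fromℕ s ∈? V
... | yes _ = 1
... | no _ = 0
capV s Fin.zero V = 0
capV s (Fin.suc Fin.zero) V = 0

{-# OPTIONS --safe #-}
module Submission where

-- Only the matching edges u_j v_j (j ≤ s) count, and u_{s+1}, v_{s+1} are exactly the vertices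
-- that the correction terms remove.  The edge u_j v_j is counted in e(Z[U,V]) + e(Z[U',V']) iff
-- both endpoints lie on the same side, and for bits b, c the number [b = c] + b + c = 1 + 2bc is
-- odd.  Summing over j gives
--   e(Z[U,V]) + e(Z[U',V']) + (|U| + |V| - |U ∩ {u_{s+1}}| - |V ∩ {v_{s+1}}|) = s + 2 e(Z[U,V]).

open import Defs
open import Data.Nat using (ℕ; zero; suc; _+_; _*_; _∸_; _%_; _<_; _≤_; s≤s; _≟_; _<?_)
open import Data.Nat.Properties
  using (+-0-monoid; +-commutativeSemigroup; +-assoc; +-comm; +-identityʳ; m+n∸n≡m; ≤-refl; n≤1+n)
open import Data.Nat.DivMod using ([m+kn]%n≡m%n; %-distribˡ-+; m%n%n≡m%n)
open import Data.Nat.Tactic.RingSolver using (solve-∀)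
open import Data.Bool using (Bool; true; false; _∧_; not)
open import Data.Bool.Properties using (∧-identityʳ; ∧-zeroʳ)
open import Data.Fin using (Fin; toℕ; fromℕ) renaming (zero to fzero; suc to fsuc)
open import Data.Fin.Subset using (Subset; ∁; ∣_∣)
open import Data.Fin.Subset.Properties using (_∈?_)
open import Data.Vec using ([]; _∷_; lookup)
open import Data.List using (List; length; filter; map; _++_; tabulate; cartesianProduct)
open import Data.List.Properties using (filter-++; length-++; map-tabulate)
open import Data.Product using (_×_; _,_)
open import Relation.Nullary using (does; yes; no)
open import Relation.Unary using (Pred; Decidable)
open import Relation.Binary.PropositionalEquality
  using (_≡_; refl; sym; trans; cong; cong₂; module ≡-Reasoning)
open import Algebra.Properties.Monoid.Sum +-0-monoid using (sum-syntax; sum-cong-≗; sum-replicate-zero)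
open import Algebra.Properties.CommutativeSemigroup +-commutativeSemigroup
  using (interchange; xy∙z≈xz∙y)
open import Function using (id; _∘_)
open import Level using (Level)

private
  variable
    ℓ : Level
    A B : Set
    n m : ℕ

bit : Bool → ℕ
bit true  = 1
bit false = 0

bit-∧-false : ∀ b → bit (b ∧ false) ≡ 0
bit-∧-false b = cong bit (∧-zeroʳ b)

∑-zero : ∀ n {f : Fin n → ℕ} → (∀ i → f i ≡ 0) → ∑[ i < n ] f i ≡ 0
∑-zero n f≡0 = trans (sum-cong-≗ f≡0) (sum-replicate-zero n)

length-filter-tabulate : {P : Pred A ℓ} (P? : Decidable P) (f : Fin n → A) →
  length (filter P? (tabulate f)) ≡ ∑[ i < n ] bit (does (P? (f i)))
length-filter-tabulate {n = zero}  P? f = refl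
length-filter-tabulate {n = suc n} P? f with does (P? (f fzero))
... | true  = cong suc (length-filter-tabulate P? (f ∘ fsuc))
... | false = length-filter-tabulate P? (f ∘ fsuc)

length-filter-cartesianProduct :
  {P : Pred (A × B) ℓ} (P? : Decidable P) (f : Fin n → A) (g : Fin m → B) →
  length (filter P? (cartesianProduct (tabulate f) (tabulate g)))
    ≡ ∑[ i < n ] ∑[ j < m ] bit (does (P? (f i , g j)))
length-filter-cartesianProduct {n = zero}  P? f g = refl
length-filter-cartesianProduct {A = A} {B = B} {n = suc n} {m = m} P? f g = begin
  length (filter P? (pairs₀ ++ pairs₊))
    ≡⟨ cong length (filter-++ P? pairs₀ pairs₊) ⟩
  length (filter P? pairs₀ ++ filter P? pairs₊)
    ≡⟨ length-++ (filter P? pairs₀) ⟩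
  length (filter P? pairs₀) + length (filter P? pairs₊)
    ≡⟨ cong₂ _+_ count₀ (length-filter-cartesianProduct P? (f ∘ fsuc) g) ⟩
  ∑[ i < suc n ] ∑[ j < m ] bit (does (P? (f i , g j))) ∎
  where
  open ≡-Reasoning
  pairs₀ pairs₊ : List (A × B)
  pairs₀ = map (f fzero ,_) (tabulate g)
  pairs₊ = cartesianProduct (tabulate (f ∘ fsuc)) (tabulate g)
  count₀ : length (filter P? pairs₀) ≡ ∑[ j < m ] bit (does (P? (f fzero , g j)))
  count₀ = trans (cong (length ∘ filter P?) (map-tabulate g (f fzero ,_)))
                 (length-filter-tabulate P? (λ j → f fzero , g j))

does-∈? : (x : Fin n) (U : Subset n) → does (x ∈? U) ≡ lookup U x
does-∈? fzero    (true  ∷ U) = refl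
does-∈? fzero    (false ∷ U) = refl
does-∈? (fsuc x) (_     ∷ U) = does-∈? x U

prefixSize : ℕ → Subset n → ℕ
prefixSize zero    _       = 0
prefixSize (suc s) []      = 0
prefixSize (suc s) (b ∷ U) = bit b + prefixSize s U

prefixOverlap : ℕ → Subset n → Subset m → ℕ
prefixOverlap zero    _       _       = 0
prefixOverlap (suc s) []      _       = 0
prefixOverlap (suc s) (_ ∷ _) []      = 0
prefixOverlap (suc s) (b ∷ U) (c ∷ V) = bit (b ∧ c) + prefixOverlap s U V

diagonalIndicator : ℕ → Subset n → Subset m → Fin n → Fin m → Bool
diagonalIndicator s U V x y =
  (lookup U x ∧ lookup V y) ∧ (does (toℕ x ≟ toℕ y) ∧ does (toℕ x <? s))

∑-diagonalIndicator : ∀ s (U : Subset n) (V : Subset m) →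
  ∑[ x < n ] ∑[ y < m ] bit (diagonalIndicator s U V x y) ≡ prefixOverlap s U V
∑-diagonalIndicator zero U V = ∑-zero _ λ x → ∑-zero _ λ y → outside x y
  where
  <?-zero : ∀ k → does (k <? 0) ≡ false
  <?-zero zero    = refl
  <?-zero (suc k) = refl
  outside : ∀ x y → bit (diagonalIndicator 0 U V x y) ≡ 0
  outside x y rewrite <?-zero (toℕ x) | ∧-zeroʳ (does (toℕ x ≟ toℕ y))
                    | ∧-zeroʳ (lookup U x ∧ lookup V y) = refl
∑-diagonalIndicator (suc s) []      V       = refl
∑-diagonalIndicator {suc n} (suc s) (b ∷ U) [] = ∑-zero (suc n) λ _ → refl
∑-diagonalIndicator {suc n} {suc m} (suc s) (b ∷ U) (c ∷ V) = cong₂ _+_ row₀ rows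
  where
  row₀ : bit ((b ∧ c) ∧ true) + ∑[ y < m ] bit ((b ∧ lookup V y) ∧ false) ≡ bit (b ∧ c)
  row₀ = trans (cong₂ _+_ (cong bit (∧-identityʳ (b ∧ c))) (∑-zero m λ y → bit-∧-false _))
               (+-identityʳ _)
  rows : ∑[ x < n ] (bit ((lookup U x ∧ c) ∧ false) + ∑[ y < m ] bit (diagonalIndicator s U V x y))
         ≡ prefixOverlap s U V
  rows = trans (sum-cong-≗ λ x → cong (_+ ∑[ y < m ] bit (diagonalIndicator s U V x y))
                                      (bit-∧-false (lookup U x ∧ c)))
               (∑-diagonalIndicator s U V)

eZ≡prefixOverlap : ∀ s i (U : Subset (nU s i)) (V : Subset (nV s i)) →
  eZ s i U V ≡ prefixOverlap s U V
eZ≡prefixOverlap s i U V = begin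
  eZ s i U V
    ≡⟨ length-filter-cartesianProduct {n = nU s i} {m = nV s i} _ id id ⟩
  ∑[ x < nU s i ] ∑[ y < nV s i ] bit ((does (x ∈? U) ∧ does (y ∈? V)) ∧ does (Edge? s i x y))
    ≡⟨ sum-cong-≗ (λ x → sum-cong-≗ λ y →
         cong (λ b → bit (b ∧ does (Edge? s i x y))) (cong₂ _∧_ (does-∈? x U) (does-∈? y V))) ⟩
  ∑[ x < nU s i ] ∑[ y < nV s i ] bit (diagonalIndicator s U V x y)
    ≡⟨ ∑-diagonalIndicator s U V ⟩
  prefixOverlap s U V ∎
  where open ≡-Reasoning

∣∣-cons : ∀ b (U : Subset n) → ∣ b ∷ U ∣ ≡ bit b + ∣ U ∣
∣∣-cons true  U = refl
∣∣-cons false U = refl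

∣∣≡prefixSize : (U : Subset n) → ∣ U ∣ ≡ prefixSize n U
∣∣≡prefixSize []      = refl
∣∣≡prefixSize (b ∷ U) = trans (∣∣-cons b U) (cong (bit b +_) (∣∣≡prefixSize U))

∣∣≡prefixSize+last : ∀ s (U : Subset (suc s)) → ∣ U ∣ ≡ prefixSize s U + bit (lookup U (fromℕ s))
∣∣≡prefixSize+last zero    (b ∷ []) = trans (∣∣-cons b []) (+-comm (bit b) 0)
∣∣≡prefixSize+last (suc s) (b ∷ U)  = begin
  ∣ b ∷ U ∣                                                ≡⟨ ∣∣-cons b U ⟩
  bit b + ∣ U ∣                                            ≡⟨ cong (bit b +_) (∣∣≡prefixSize+last s U) ⟩
  bit b + (prefixSize s U + bit (lookup U (fromℕ s)))      ≡⟨ +-assoc (bit b) _ _ ⟨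
  bit b + prefixSize s U + bit (lookup U (fromℕ s))        ∎
  where open ≡-Reasoning

capU-lookup : ∀ s (U : Subset (suc s)) → capU s (fsuc fzero) U ≡ bit (lookup U (fromℕ s))
capU-lookup s U rewrite sym (does-∈? (fromℕ s) U) with fromℕ s ∈? U
... | yes _ = refl
... | no  _ = refl

capV-lookup : ∀ s (V : Subset (suc s)) → capV s (fsuc (fsuc fzero)) V ≡ bit (lookup V (fromℕ s))
capV-lookup s V rewrite sym (does-∈? (fromℕ s) V) with fromℕ s ∈? V
... | yes _ = refl
... | no  _ = refl

vertexCount≡prefixSizes : ∀ s i (U : Subset (nU s i)) (V : Subset (nV s i)) →
  ∣ U ∣ + ∣ V ∣ ∸ capU s i U ∸ capV s i V ≡ prefixSize s U + prefixSize s V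
vertexCount≡prefixSizes s fzero U V = cong₂ _+_ (∣∣≡prefixSize U) (∣∣≡prefixSize V)
vertexCount≡prefixSizes s (fsuc fzero) U V = begin
  ∣ U ∣ + ∣ V ∣ ∸ capU s (fsuc fzero) U
    ≡⟨ cong₂ _∸_ (cong₂ _+_ (∣∣≡prefixSize+last s U) (∣∣≡prefixSize V)) (capU-lookup s U) ⟩
  prefixSize s U + u + prefixSize s V ∸ u
    ≡⟨ cong (_∸ u) (xy∙z≈xz∙y (prefixSize s U) u (prefixSize s V)) ⟩
  prefixSize s U + prefixSize s V + u ∸ u
    ≡⟨ m+n∸n≡m _ u ⟩
  prefixSize s U + prefixSize s V ∎
  where
  open ≡-Reasoning
  u : ℕ
  u = bit (lookup U (fromℕ s))
vertexCount≡prefixSizes s (fsuc (fsuc fzero)) U V = begin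
  ∣ U ∣ + ∣ V ∣ ∸ capV s (fsuc (fsuc fzero)) V
    ≡⟨ cong₂ _∸_ (cong₂ _+_ (∣∣≡prefixSize U) (∣∣≡prefixSize+last s V)) (capV-lookup s V) ⟩
  prefixSize s U + (prefixSize s V + v) ∸ v
    ≡⟨ cong (_∸ v) (+-assoc (prefixSize s U) (prefixSize s V) v) ⟨
  prefixSize s U + prefixSize s V + v ∸ v
    ≡⟨ m+n∸n≡m _ v ⟩
  prefixSize s U + prefixSize s V ∎
  where
  open ≡-Reasoning
  v : ℕ
  v = bit (lookup V (fromℕ s))

bit-∧-parity : ∀ b c → bit (b ∧ c) + bit (not b ∧ not c) + (bit b + bit c) ≡ 1 + 2 * bit (b ∧ c)
bit-∧-parity true  true  = refl
bit-∧-parity true  false = refl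
bit-∧-parity false true  = refl
bit-∧-parity false false = refl

prefixOverlap-parity : ∀ s (U : Subset n) (V : Subset m) → s ≤ n → s ≤ m →
  prefixOverlap s U V + prefixOverlap s (∁ U) (∁ V) + (prefixSize s U + prefixSize s V)
    ≡ s + 2 * prefixOverlap s U V
prefixOverlap-parity zero    U       V       _         _         = refl
prefixOverlap-parity (suc s) (b ∷ U) (c ∷ V) (s≤s s≤n) (s≤s s≤m) = begin
  (bit (b ∧ c) + o) + (bit (not b ∧ not c) + o') + ((bit b + p) + (bit c + q))
    ≡⟨ cong₂ _+_ (interchange (bit (b ∧ c)) o _ o') (interchange (bit b) p (bit c) q) ⟩
  (bit (b ∧ c) + bit (not b ∧ not c) + (o + o')) + ((bit b + bit c) + (p + q))
    ≡⟨ interchange (bit (b ∧ c) + bit (not b ∧ not c)) (o + o') (bit b + bit c) (p + q) ⟩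
  (bit (b ∧ c) + bit (not b ∧ not c) + (bit b + bit c)) + (o + o' + (p + q))
    ≡⟨ cong₂ _+_ (bit-∧-parity b c) (prefixOverlap-parity s U V s≤n s≤m) ⟩
  (1 + 2 * bit (b ∧ c)) + (s + 2 * o)
    ≡⟨ regroup (bit (b ∧ c)) s o ⟩
  suc s + 2 * (bit (b ∧ c) + o) ∎
  where
  open ≡-Reasoning
  o o' p q : ℕ
  o = prefixOverlap s U V
  o' = prefixOverlap s (∁ U) (∁ V)
  p = prefixSize s U
  q = prefixSize s V
  regroup : ∀ a s o → (1 + 2 * a) + (s + 2 * o) ≡ suc s + 2 * (a + o)
  regroup = solve-∀

m+n≡o+2k⇒m%2≡[n%2+o]%2 : ∀ {m n o k} → m + n ≡ o + 2 * k → m % 2 ≡ (n % 2 + o) % 2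
m+n≡o+2k⇒m%2≡[n%2+o]%2 {m} {n} {o} {k} eq = begin
  m % 2                    ≡⟨ [m+kn]%n≡m%n m n 2 ⟨
  (m + n * 2) % 2          ≡⟨ cong (_% 2) (double m n) ⟩
  (m + n + n) % 2          ≡⟨ cong (λ t → (t + n) % 2) eq ⟩
  (o + 2 * k + n) % 2      ≡⟨ cong (_% 2) (swap o k n) ⟩
  (n + o + k * 2) % 2      ≡⟨ [m+kn]%n≡m%n (n + o) k 2 ⟩
  (n + o) % 2              ≡⟨ %-distribˡ-+ n o 2 ⟩
  (n % 2 + o % 2) % 2      ≡⟨ cong (λ r → (r + o % 2) % 2) (m%n%n≡m%n n 2) ⟨
  (n % 2 % 2 + o % 2) % 2  ≡⟨ %-distribˡ-+ (n % 2) o 2 ⟨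
  (n % 2 + o) % 2          ∎
  where
  open ≡-Reasoning
  double : ∀ m n → m + n * 2 ≡ m + n + n
  double = solve-∀
  swap : ∀ o k n → o + 2 * k + n ≡ n + o + k * 2
  swap = solve-∀

s≤nU : ∀ s i → s ≤ nU s i
s≤nU s fzero               = ≤-refl
s≤nU s (fsuc fzero)        = n≤1+n s
s≤nU s (fsuc (fsuc fzero)) = ≤-refl

s≤nV : ∀ s i → s ≤ nV s i
s≤nV s fzero               = ≤-refl
s≤nV s (fsuc fzero)        = ≤-refl
s≤nV s (fsuc (fsuc fzero)) = n≤1+n s

lemma2p2 : (s : ℕ) → 0 < s → (i : Fin 3) → (U : Subset (nU s i)) → (V : Subset (nV s i)) →
    ((∣ U ∣ + ∣ V ∣ ∸ capU s i U ∸ capV s i V) % 2 ≡ 0 →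
      (eZ s i U V + eZ s i (∁ U) (∁ V)) % 2 ≡ s % 2)
    × ((∣ U ∣ + ∣ V ∣ ∸ capU s i U ∸ capV s i V) % 2 ≡ 1 →
      (eZ s i U V + eZ s i (∁ U) (∁ V)) % 2 ≡ suc s % 2)
lemma2p2 s _ i U V = (λ even → trans parity (cong (λ r → (r + s) % 2) even))
                   , (λ odd  → trans parity (cong (λ r → (r + s) % 2) odd))
  where
  open ≡-Reasoning
  edges vertices : ℕ
  edges = eZ s i U V + eZ s i (∁ U) (∁ V)
  vertices = ∣ U ∣ + ∣ V ∣ ∸ capU s i U ∸ capV s i V
  parity : edges % 2 ≡ (vertices % 2 + s) % 2
  parity = m+n≡o+2k⇒m%2≡[n%2+o]%2 {edges} {vertices} {s} {prefixOverlap s U V} (begin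
    edges + vertices
      ≡⟨ cong₂ _+_ (cong₂ _+_ (eZ≡prefixOverlap s i U V) (eZ≡prefixOverlap s i (∁ U) (∁ V)))
                   (vertexCount≡prefixSizes s i U V) ⟩
    prefixOverlap s U V + prefixOverlap s (∁ U) (∁ V) + (prefixSize s U + prefixSize s V)
      ≡⟨ prefixOverlap-parity s U V (s≤nU s i) (s≤nV s i) ⟩
    s + 2 * prefixOverlap s U V ∎)
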